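{- Let $M$ be a matroid on an $n$-element ground set $E$. Then \[W_{M}(X,Y,Z)=\sum_{j=0}^{n}\sum_{\gamma\subseteq E,\,|\gamma|=j}Z^{n_{M}(E\smallsetminus \gamma)}(X-Y)^{j}Y^{n-j}.\]
   Context: For a matroid $M$ on $E$ with rank function $r_M$, the nullity is $n_M(\sigma)=|\sigma|-r_M(\sigma)$. Generalized weight polynomials: $P_{M,0}(Z)=1$ and, for $1\le j\le n$, $P_{M,j}(Z)=(-1)^j\sum_{|\sigma|=j}\sum_{\gamma\subseteq\sigma}(-1)^{|\gamma|}Z^{n_M(\gamma)}$ (sums over subsets of $E$). The enumerator of $M$ is $W_M(X,Y,Z)=\sum_{i=0}^{n}P_{M,i}(Z)X^{n-i}Y^i$. -}

module Defs where

open import Level using (Level)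
open import Data.Nat as ℕ using (ℕ; zero; suc; _∸_; _≤_)
open import Data.Bool using (Bool; true; false)
open import Data.Vec using (Vec; []; _∷_)
open import Data.List as List using (List; []; _∷_; _++_; filter; map)
open import Data.Fin.Subset using (Subset; _⊆_; _∪_; _∩_; ∣_∣; ⊥; ⊤; ∁)
open import Data.Fin.Subset.Properties using (_⊆?_)
open import Relation.Binary.PropositionalEquality using (_≡_)
open import Algebra.Bundles using (CommutativeRing)

record Matroid (n : ℕ) : Set where
  field
    rank       : Subset n → ℕ
    rank-≤     : ∀ A → rank A ≤ ∣ A ∣
    rank-mono  : ∀ {A B} → A ⊆ B → rank A ≤ rank B
    rank-submod : ∀ A B → rank (A ∪ B) ℕ.+ rank (A ∩ B) ≤ rank A ℕ.+ rank B

open Matroid public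

-- nullity n_M(σ) = |σ| - r_M(σ)   (truncated subtraction is exact by rank-≤)
nullity : ∀ {n} → Matroid n → Subset n → ℕ
nullity M σ = ∣ σ ∣ ∸ rank M σ

allSubsets : (n : ℕ) → List (Subset n)
allSubsets zero = [] ∷ []
allSubsets (suc n) = map (false ∷_) (allSubsets n) ++ map (true ∷_) (allSubsets n)

subsetsOfSize : (n j : ℕ) → List (Subset n)
subsetsOfSize n j = filter (λ σ → ∣ σ ∣ ℕ.≟ j) (allSubsets n)

subsetsOf : ∀ {n} → Subset n → List (Subset n)
subsetsOf {n} σ = filter (λ γ → γ ⊆? σ) (allSubsets n)

-- Polynomial expressions are evaluated in an arbitrary commutative ring;
-- an identity holding in every commutative ring is exactly an identity
-- in ℤ[X,Y,Z].
module Poly {c ℓ : Level} (R : CommutativeRing c ℓ) where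
  open CommutativeRing R hiding (zero)

  pow : Carrier → ℕ → Carrier
  pow x zero = 1#
  pow x (suc k) = x * pow x k

  sumL : ∀ {a} {A : Set a} → (A → Carrier) → List A → Carrier
  sumL f [] = 0#
  sumL f (x ∷ xs) = f x + sumL f xs

  sumTo : ℕ → (ℕ → Carrier) → Carrier
  sumTo zero f = f zero
  sumTo (suc m) f = sumTo m f + f (suc m)

  sign : ℕ → Carrier
  sign k = pow (- 1#) k

  P : ∀ {n} → Matroid n → ℕ → Carrier → Carrier
  P M zero Z = 1#
  P {n} M (suc j) Z =
    sign (suc j) * sumL (λ σ → sumL (λ γ → sign ∣ γ ∣ * pow Z (nullity M γ)) (subsetsOf σ))
                        (subsetsOfSize n (suc j))

  W : ∀ {n} → Matroid n → Carrier → Carrier → Carrier → Carrier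
  W {n} M X Y Z = sumTo n (λ i → P M i Z * pow X (n ∸ i) * pow Y i)

module Submission where

-- Write f γ = Z^{n_M(γ)} and D = X - Y.  Grouping the terms of
-- W_M by the set σ of size i that indexes them (the formula defining P_{M,i}
-- also holds for i = 0), W_M is the sum over all pairs γ ⊆ σ ⊆ E of
--     (-1)^{|σ|} X^{n-|σ|} Y^{|σ|} · (-1)^{|γ|} f γ.
-- Exchanging the two sums, the inner sum over σ ⊇ γ is a binomial expansion:
--     Σ_{σ ⊇ γ} a^{|σ|} b^{n-|σ|} = a^{|γ|} (a + b)^{n-|γ|},
-- which for a = -Y, b = X gives (-1)^{|γ|} Y^{|γ|} D^{n-|γ|}; the two signs
-- cancel, so W_M = Σ_γ f γ · Y^{|γ|} D^{n-|γ|}.  Reindexing by γ ↦ E ∖ γ and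
-- regrouping by size gives the right-hand side.  No matroid axiom is needed.

open import Defs
open import Data.Nat using (ℕ; zero; suc; _∸_; _≤_; _<_; _≟_)
open import Data.Fin.Subset using (Subset; ∣_∣; ⊥; ∁)
open import Algebra.Bundles using (CommutativeRing)
open import Data.Nat.Properties
  using (≤-pred; ≤-refl; <-trans; n<1+n; <⇒≢; m≤n⇒m<n∨m≡n; +-∸-assoc; m∸[m∸n]≡n; 0∸n≡0)
open import Data.Bool using (Bool; true; false)
open import Data.Bool.Properties using (not-involutive)
open import Data.Sum using (inj₁; inj₂)
open import Data.Vec using ([]; _∷_)
open import Data.List using (List; []; _∷_; _++_; map; filter)
open import Data.Fin.Subset.Properties using (_⊆?_; ∣p∣≤n; ∣∁p∣≡n∸∣p∣; ∣⊥∣≡0)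
open import Relation.Nullary using (does; ¬_)
open import Relation.Nullary.Decidable using (dec-true; dec-false)
open import Relation.Unary using (Decidable)
open import Relation.Binary.PropositionalEquality as ≡ using (_≡_)
import Algebra.Solver.Ring.NaturalCoefficients.Default as Solver
import Algebra.Properties.Ring as RingProperties
import Relation.Binary.Reasoning.Setoid as SetoidReasoning

∁-involutive : ∀ {n} (p : Subset n) → ∁ (∁ p) ≡ p
∁-involutive []      = ≡.refl
∁-involutive (x ∷ p) = ≡.cong₂ _∷_ (not-involutive x) (∁-involutive p)

module Theory {c ℓ} (R : CommutativeRing c ℓ) where
  open CommutativeRing R hiding (zero)
  open Poly R
  open Solver commutativeSemiring
  open SetoidReasoning setoid
  open RingProperties ring using (-1*x≈-x; -‿involutive)

  when : Bool → Carrier → Carrier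
  when true  x = x
  when false x = 0#

  when-cong : ∀ b {x y} → x ≈ y → when b x ≈ when b y
  when-cong true  x≈y = x≈y
  when-cong false x≈y = refl

  when-*ˡ : ∀ b k x → when b (k * x) ≈ k * when b x
  when-*ˡ true  k x = refl
  when-*ˡ false k x = sym (zeroʳ k)

  when-swap : ∀ b a x → a * when b x ≈ x * when b a
  when-swap true  a x = *-comm a x
  when-swap false a x = trans (zeroʳ a) (sym (zeroʳ x))

  when-≢ : ∀ {k j} → ¬ k ≡ j → ∀ x → when (does (k ≟ j)) x ≈ 0#
  when-≢ {k} {j} k≢j x rewrite dec-false (k ≟ j) k≢j = refl

  when-≡ : ∀ k x → when (does (k ≟ k)) x ≈ x
  when-≡ k x rewrite dec-true (k ≟ k) ≡.refl = refl

  sumL-cong : ∀ {a} {A : Set a} {f g : A → Carrier} (xs : List A) →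
              (∀ x → f x ≈ g x) → sumL f xs ≈ sumL g xs
  sumL-cong []       f≈g = refl
  sumL-cong (x ∷ xs) f≈g = +-cong (f≈g x) (sumL-cong xs f≈g)

  sumL-++ : ∀ {a} {A : Set a} (f : A → Carrier) (xs ys : List A) →
            sumL f (xs ++ ys) ≈ sumL f xs + sumL f ys
  sumL-++ f []       ys = sym (+-identityˡ _)
  sumL-++ f (x ∷ xs) ys = trans (+-cong refl (sumL-++ f xs ys)) (sym (+-assoc _ _ _))

  sumL-map : ∀ {a b} {A : Set a} {B : Set b} (f : B → Carrier) (h : A → B) (xs : List A) →
             sumL f (map h xs) ≡ sumL (λ x → f (h x)) xs
  sumL-map f h []       = ≡.refl
  sumL-map f h (x ∷ xs) = ≡.cong (f (h x) +_) (sumL-map f h xs)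

  sumL-zero : ∀ {a} {A : Set a} (xs : List A) → sumL (λ _ → 0#) xs ≈ 0#
  sumL-zero []       = refl
  sumL-zero (x ∷ xs) = trans (+-identityˡ _) (sumL-zero xs)

  sumL-+ : ∀ {a} {A : Set a} (f g : A → Carrier) (xs : List A) →
           sumL (λ x → f x + g x) xs ≈ sumL f xs + sumL g xs
  sumL-+ f g []       = sym (+-identityˡ _)
  sumL-+ f g (x ∷ xs) = trans (+-cong refl (sumL-+ f g xs)) (interchange (f x) (g x) _ _)
    where
    interchange : ∀ a b c d → (a + b) + (c + d) ≈ (a + c) + (b + d)
    interchange = solve 4 (λ a b c d → (a :+ b) :+ (c :+ d) := (a :+ c) :+ (b :+ d)) refl

  sumL-*ˡ : ∀ {a} {A : Set a} (k : Carrier) (f : A → Carrier) (xs : List A) →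
            sumL (λ x → k * f x) xs ≈ k * sumL f xs
  sumL-*ˡ k f []       = sym (zeroʳ k)
  sumL-*ˡ k f (x ∷ xs) = trans (+-cong refl (sumL-*ˡ k f xs)) (sym (distribˡ k _ _))

  sumL-filter : ∀ {a p} {A : Set a} {Pr : A → Set p} (P? : Decidable Pr) (f : A → Carrier)
                (xs : List A) → sumL f (filter P? xs) ≈ sumL (λ x → when (does (P? x)) (f x)) xs
  sumL-filter P? f [] = refl
  sumL-filter P? f (x ∷ xs) with does (P? x)
  ... | true  = +-cong refl (sumL-filter P? f xs)
  ... | false = trans (sumL-filter P? f xs) (sym (+-identityˡ _))

  sumL-exchange : ∀ {a b} {A : Set a} {B : Set b} (g : A → B → Carrier) (xs : List A) (ys : List B) →
                  sumL (λ x → sumL (g x) ys) xs ≈ sumL (λ y → sumL (λ x → g x y) xs) ys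
  sumL-exchange g []       ys = sym (sumL-zero ys)
  sumL-exchange g (x ∷ xs) ys =
    trans (+-cong refl (sumL-exchange g xs ys)) (sym (sumL-+ (g x) (λ y → sumL (λ x′ → g x′ y) xs) ys))

  sumTo-cong : ∀ m {f g : ℕ → Carrier} → (∀ j → f j ≈ g j) → sumTo m f ≈ sumTo m g
  sumTo-cong zero    f≈g = f≈g 0
  sumTo-cong (suc m) f≈g = +-cong (sumTo-cong m f≈g) (f≈g (suc m))

  sumTo-sumL : ∀ {a} {A : Set a} m (g : ℕ → A → Carrier) (xs : List A) →
               sumTo m (λ j → sumL (g j) xs) ≈ sumL (λ x → sumTo m (λ j → g j x)) xs
  sumTo-sumL zero    g xs = refl
  sumTo-sumL (suc m) g xs =
    trans (+-cong (sumTo-sumL m g xs) refl) (sym (sumL-+ (λ x → sumTo m (λ j → g j x)) (g (suc m)) xs))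

  sumTo-δ-outside : ∀ k m (h : ℕ → Carrier) → m < k → sumTo m (λ j → when (does (k ≟ j)) (h j)) ≈ 0#
  sumTo-δ-outside k zero    h m<k = when-≢ (λ k≡0 → <⇒≢ m<k (≡.sym k≡0)) (h 0)
  sumTo-δ-outside k (suc m) h m<k =
    trans (+-cong (sumTo-δ-outside k m h (<-trans (n<1+n m) m<k))
                  (when-≢ (λ k≡m → <⇒≢ m<k (≡.sym k≡m)) _))
          (+-identityˡ _)

  sumTo-δ : ∀ k m (h : ℕ → Carrier) → k ≤ m → sumTo m (λ j → when (does (k ≟ j)) (h j)) ≈ h k
  sumTo-δ zero    zero    h k≤m = refl
  sumTo-δ (suc k) zero    h ()
  sumTo-δ k       (suc m) h k≤m with m≤n⇒m<n∨m≡n k≤m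
  ... | inj₁ k<1+m =
    trans (+-cong (sumTo-δ k m h (≤-pred k<1+m)) (when-≢ (<⇒≢ k<1+m) _)) (+-identityʳ _)
  ... | inj₂ ≡.refl =
    trans (+-cong (sumTo-δ-outside k m h ≤-refl) (when-≡ k _)) (+-identityˡ _)

  sumAll : (n : ℕ) → (Subset n → Carrier) → Carrier
  sumAll n g = sumL g (allSubsets n)

  sumAll-cong : ∀ n {g h : Subset n → Carrier} → (∀ σ → g σ ≈ h σ) → sumAll n g ≈ sumAll n h
  sumAll-cong n = sumL-cong (allSubsets n)

  sumAll-suc : ∀ n (g : Subset (suc n) → Carrier) →
               sumAll (suc n) g ≈ sumAll n (λ σ → g (false ∷ σ)) + sumAll n (λ σ → g (true ∷ σ))
  sumAll-suc n g =
    trans (sumL-++ g (map (false ∷_) (allSubsets n)) (map (true ∷_) (allSubsets n)))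
          (+-cong (reflexive (sumL-map g (false ∷_) (allSubsets n)))
                  (reflexive (sumL-map g (true ∷_) (allSubsets n))))

  sumAll-∁ : ∀ n (g : Subset n → Carrier) → sumAll n g ≈ sumAll n (λ σ → g (∁ σ))
  sumAll-∁ zero    g = refl
  sumAll-∁ (suc n) g = begin
    sumAll (suc n) g
      ≈⟨ sumAll-suc n g ⟩
    sumAll n (λ σ → g (false ∷ σ)) + sumAll n (λ σ → g (true ∷ σ))
      ≈⟨ +-cong (sumAll-∁ n (λ σ → g (false ∷ σ))) (sumAll-∁ n (λ σ → g (true ∷ σ))) ⟩
    sumAll n (λ σ → g (false ∷ ∁ σ)) + sumAll n (λ σ → g (true ∷ ∁ σ))
      ≈⟨ +-comm _ _ ⟩
    sumAll n (λ σ → g (true ∷ ∁ σ)) + sumAll n (λ σ → g (false ∷ ∁ σ))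
      ≈⟨ sym (sumAll-suc n (λ σ → g (∁ σ))) ⟩
    sumAll (suc n) (λ σ → g (∁ σ)) ∎

  sumAll-bySize : ∀ n (h : ℕ → Subset n → Carrier) →
                  sumTo n (λ j → sumL (h j) (subsetsOfSize n j)) ≈ sumAll n (λ σ → h ∣ σ ∣ σ)
  sumAll-bySize n h = begin
    sumTo n (λ j → sumL (h j) (subsetsOfSize n j))
      ≈⟨ sumTo-cong n (λ j → sumL-filter (λ σ → ∣ σ ∣ ≟ j) (h j) (allSubsets n)) ⟩
    sumTo n (λ j → sumAll n (λ σ → when (does (∣ σ ∣ ≟ j)) (h j σ)))
      ≈⟨ sumTo-sumL n (λ j σ → when (does (∣ σ ∣ ≟ j)) (h j σ)) (allSubsets n) ⟩
    sumAll n (λ σ → sumTo n (λ j → when (does (∣ σ ∣ ≟ j)) (h j σ)))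
      ≈⟨ sumAll-cong n (λ σ → sumTo-δ ∣ σ ∣ n (λ j → h j σ) (∣p∣≤n σ)) ⟩
    sumAll n (λ σ → h ∣ σ ∣ σ) ∎

  sumAll-size-0 : ∀ n (g : Subset n → Carrier) → sumAll n (λ σ → when (does (∣ σ ∣ ≟ 0)) (g σ)) ≈ g ⊥
  sumAll-size-0 zero    g = +-identityʳ _
  sumAll-size-0 (suc n) g =
    trans (sumAll-suc n _)
          (trans (+-cong (sumAll-size-0 n (λ σ → g (false ∷ σ))) (sumL-zero (allSubsets n))) (+-identityʳ _))

  sumAll-⊆⊥ : ∀ n (g : Subset n → Carrier) → sumAll n (λ σ → when (does (σ ⊆? ⊥)) (g σ)) ≈ g ⊥
  sumAll-⊆⊥ zero    g = +-identityʳ _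
  sumAll-⊆⊥ (suc n) g =
    trans (sumAll-suc n _)
          (trans (+-cong (sumAll-⊆⊥ n (λ σ → g (false ∷ σ))) (sumL-zero (allSubsets n))) (+-identityʳ _))

  sum-size-0-subsets : ∀ n (g : Subset n → Carrier) →
                       sumL (λ σ → sumL g (subsetsOf σ)) (subsetsOfSize n 0) ≈ g ⊥
  sum-size-0-subsets n g = begin
    sumL (λ σ → sumL g (subsetsOf σ)) (subsetsOfSize n 0)
      ≈⟨ sumL-filter (λ σ → ∣ σ ∣ ≟ 0) _ (allSubsets n) ⟩
    sumAll n (λ σ → when (does (∣ σ ∣ ≟ 0)) (sumL g (subsetsOf σ)))
      ≈⟨ sumAll-size-0 n (λ σ → sumL g (subsetsOf σ)) ⟩
    sumL g (subsetsOf ⊥)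
      ≈⟨ sumL-filter (λ γ → γ ⊆? ⊥) g (allSubsets n) ⟩
    sumAll n (λ γ → when (does (γ ⊆? ⊥)) (g γ))
      ≈⟨ sumAll-⊆⊥ n g ⟩
    g ⊥ ∎

  pow-cong : ∀ {x y} k → x ≈ y → pow x k ≈ pow y k
  pow-cong zero    x≈y = refl
  pow-cong (suc k) x≈y = *-cong x≈y (pow-cong k x≈y)

  sign-square : ∀ k → sign k * sign k ≈ 1#
  sign-square zero    = *-identityˡ 1#
  sign-square (suc k) = begin
    (- 1# * sign k) * (- 1# * sign k)
      ≈⟨ solve 2 (λ m s → (m :* s) :* (m :* s) := (m :* m) :* (s :* s)) refl (- 1#) (sign k) ⟩
    (- 1# * - 1#) * (sign k * sign k)
      ≈⟨ *-cong (trans (-1*x≈-x (- 1#)) (-‿involutive 1#)) (sign-square k) ⟩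
    1# * 1#
      ≈⟨ *-identityˡ 1# ⟩
    1# ∎

  pow-neg : ∀ x k → pow (- x) k ≈ sign k * pow x k
  pow-neg x zero    = sym (*-identityˡ 1#)
  pow-neg x (suc k) = begin
    - x * pow (- x) k
      ≈⟨ *-cong (sym (-1*x≈-x x)) (pow-neg x k) ⟩
    (- 1# * x) * (sign k * pow x k)
      ≈⟨ solve 4 (λ m x s p → (m :* x) :* (s :* p) := (m :* s) :* (x :* p)) refl (- 1#) x (sign k) (pow x k) ⟩
    sign (suc k) * pow x (suc k) ∎

  module Binomial (a b : Carrier) where

    term : ∀ m → Subset m → Carrier
    term m σ = pow a ∣ σ ∣ * pow b (m ∸ ∣ σ ∣)

    present : ∀ n (σ : Subset n) → term (suc n) (true ∷ σ) ≈ a * term n σ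
    present n σ = *-assoc a _ _

    absent : ∀ n (σ : Subset n) → term (suc n) (false ∷ σ) ≈ b * term n σ
    absent n σ = begin
      pow a ∣ σ ∣ * pow b (suc n ∸ ∣ σ ∣)
        ≈⟨ *-cong refl (reflexive (≡.cong (pow b) (+-∸-assoc 1 (∣p∣≤n σ)))) ⟩
      pow a ∣ σ ∣ * (b * pow b (n ∸ ∣ σ ∣))
        ≈⟨ solve 3 (λ p b q → p :* (b :* q) := b :* (p :* q)) refl (pow a ∣ σ ∣) b (pow b (n ∸ ∣ σ ∣)) ⟩
      b * term n σ ∎

    above : ∀ n → Subset n → (Subset n → Carrier) → Carrier
    above n γ u = sumAll n (λ σ → when (does (γ ⊆? σ)) (u σ))

    above-scaled : ∀ n (γ : Subset n) k {u : Subset n → Carrier} →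
                   (∀ σ → u σ ≈ k * term n σ) → above n γ u ≈ k * above n γ (term n)
    above-scaled n γ k u≈kt =
      trans (sumAll-cong n (λ σ → trans (when-cong (does (γ ⊆? σ)) (u≈kt σ))
                                        (when-*ˡ (does (γ ⊆? σ)) k (term n σ))))
            (sumL-*ˡ k _ (allSubsets n))

    binomial-above : ∀ n (γ : Subset n) → above n γ (term n) ≈ pow a ∣ γ ∣ * pow (a + b) (n ∸ ∣ γ ∣)
    binomial-above zero    []         = +-identityʳ _
    binomial-above (suc n) (true ∷ γ) = begin
      above (suc n) (true ∷ γ) (term (suc n))
        ≈⟨ sumAll-suc n _ ⟩
      sumL (λ _ → 0#) (allSubsets n) + above n γ (λ σ → term (suc n) (true ∷ σ))
        ≈⟨ +-cong (sumL-zero (allSubsets n)) (above-scaled n γ a (present n)) ⟩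
      0# + a * above n γ (term n)
        ≈⟨ trans (+-identityˡ _) (*-cong refl (binomial-above n γ)) ⟩
      a * (pow a ∣ γ ∣ * pow (a + b) (n ∸ ∣ γ ∣))
        ≈⟨ sym (*-assoc _ _ _) ⟩
      pow a (suc ∣ γ ∣) * pow (a + b) (n ∸ ∣ γ ∣) ∎
    binomial-above (suc n) (false ∷ γ) = begin
      above (suc n) (false ∷ γ) (term (suc n))
        ≈⟨ sumAll-suc n _ ⟩
      above n γ (λ σ → term (suc n) (false ∷ σ)) + above n γ (λ σ → term (suc n) (true ∷ σ))
        ≈⟨ +-cong (above-scaled n γ b (absent n)) (above-scaled n γ a (present n)) ⟩
      b * above n γ (term n) + a * above n γ (term n)
        ≈⟨ +-cong (*-cong refl (binomial-above n γ)) (*-cong refl (binomial-above n γ)) ⟩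
      b * (p * q) + a * (p * q)
        ≈⟨ solve 4 (λ a b p q → b :* (p :* q) :+ a :* (p :* q) := p :* ((a :+ b) :* q)) refl a b p q ⟩
      p * ((a + b) * q)
        ≈⟨ *-cong refl (reflexive (≡.cong (pow (a + b)) (≡.sym (+-∸-assoc 1 (∣p∣≤n γ))))) ⟩
      p * pow (a + b) (suc n ∸ ∣ γ ∣) ∎
      where
      p = pow a ∣ γ ∣
      q = pow (a + b) (n ∸ ∣ γ ∣)

  -- The defining formula of P_{M,j} also holds for j = 0, because the empty
  -- set has size 0 and nullity 0.
  P-formula : ∀ {n} (M : Matroid n) Z j → P M j Z ≈
    sign j * sumL (λ σ → sumL (λ γ → sign ∣ γ ∣ * pow Z (nullity M γ)) (subsetsOf σ)) (subsetsOfSize n j)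
  P-formula M Z (suc j) = refl
  P-formula {n} M Z zero = sym (trans (*-identityˡ _) (trans (sum-size-0-subsets n _) empty-term))
    where
    empty-term : sign ∣ ⊥ {n = n} ∣ * pow Z (nullity M ⊥) ≈ 1#
    empty-term = trans (*-cong (reflexive (≡.cong sign (∣⊥∣≡0 n)))
                               (reflexive (≡.cong (pow Z) (≡.trans (≡.cong (_∸ rank M ⊥) (∣⊥∣≡0 n))
                                                                   (0∸n≡0 (rank M ⊥))))))
                       (*-identityˡ 1#)

  module Inversion (n : ℕ) (X Y : Carrier) where
    open Binomial (- Y) X using (term; binomial-above)

    coefficient : ℕ → Carrier
    coefficient j = sign j * pow X (n ∸ j) * pow Y j

    coefficient-binomial : ∀ (σ : Subset n) → coefficient ∣ σ ∣ ≈ term n σ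
    coefficient-binomial σ =
      trans (solve 3 (λ s x y → s :* x :* y := (s :* y) :* x) refl (sign ∣ σ ∣) (pow X (n ∸ ∣ σ ∣)) (pow Y ∣ σ ∣))
            (*-cong (sym (pow-neg Y ∣ σ ∣)) refl)

    coefficients-above : ∀ (γ : Subset n) →
      sumAll n (λ σ → when (does (γ ⊆? σ)) (coefficient ∣ σ ∣))
        ≈ sign ∣ γ ∣ * pow Y ∣ γ ∣ * pow (X - Y) (n ∸ ∣ γ ∣)
    coefficients-above γ = begin
      sumAll n (λ σ → when (does (γ ⊆? σ)) (coefficient ∣ σ ∣))
        ≈⟨ sumAll-cong n (λ σ → when-cong (does (γ ⊆? σ)) (coefficient-binomial σ)) ⟩
      sumAll n (λ σ → when (does (γ ⊆? σ)) (term n σ))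
        ≈⟨ binomial-above n γ ⟩
      pow (- Y) ∣ γ ∣ * pow (- Y + X) (n ∸ ∣ γ ∣)
        ≈⟨ *-cong (pow-neg Y ∣ γ ∣) (pow-cong (n ∸ ∣ γ ∣) (+-comm (- Y) X)) ⟩
      sign ∣ γ ∣ * pow Y ∣ γ ∣ * pow (X - Y) (n ∸ ∣ γ ∣) ∎

    inversion : ∀ (f : Subset n → Carrier) →
      sumAll n (λ σ → coefficient ∣ σ ∣ * sumL (λ γ → sign ∣ γ ∣ * f γ) (subsetsOf σ))
        ≈ sumAll n (λ γ → f γ * pow Y ∣ γ ∣ * pow (X - Y) (n ∸ ∣ γ ∣))
    inversion f = begin
      sumAll n (λ σ → coefficient ∣ σ ∣ * sumL signed (subsetsOf σ))
        ≈⟨ sumAll-cong n (λ σ → *-cong refl (sumL-filter (λ γ → γ ⊆? σ) signed (allSubsets n))) ⟩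
      sumAll n (λ σ → coefficient ∣ σ ∣ * sumAll n (λ γ → when (does (γ ⊆? σ)) (signed γ)))
        ≈⟨ sumAll-cong n (λ σ → sym (sumL-*ˡ (coefficient ∣ σ ∣) _ (allSubsets n))) ⟩
      sumAll n (λ σ → sumAll n (λ γ → coefficient ∣ σ ∣ * when (does (γ ⊆? σ)) (signed γ)))
        ≈⟨ sumL-exchange (λ σ γ → coefficient ∣ σ ∣ * when (does (γ ⊆? σ)) (signed γ))
                         (allSubsets n) (allSubsets n) ⟩
      sumAll n (λ γ → sumAll n (λ σ → coefficient ∣ σ ∣ * when (does (γ ⊆? σ)) (signed γ)))
        ≈⟨ sumAll-cong n (λ γ → sumAll-cong n (λ σ → when-swap (does (γ ⊆? σ)) _ _)) ⟩
      sumAll n (λ γ → sumAll n (λ σ → signed γ * when (does (γ ⊆? σ)) (coefficient ∣ σ ∣)))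
        ≈⟨ sumAll-cong n (λ γ → sumL-*ˡ (signed γ) _ (allSubsets n)) ⟩
      sumAll n (λ γ → signed γ * sumAll n (λ σ → when (does (γ ⊆? σ)) (coefficient ∣ σ ∣)))
        ≈⟨ sumAll-cong n (λ γ → trans (*-cong refl (coefficients-above γ)) (signs-cancel γ)) ⟩
      sumAll n (λ γ → f γ * pow Y ∣ γ ∣ * pow (X - Y) (n ∸ ∣ γ ∣)) ∎
      where
      signed : Subset n → Carrier
      signed γ = sign ∣ γ ∣ * f γ
      signs-cancel : ∀ γ → signed γ * (sign ∣ γ ∣ * pow Y ∣ γ ∣ * pow (X - Y) (n ∸ ∣ γ ∣))
                             ≈ f γ * pow Y ∣ γ ∣ * pow (X - Y) (n ∸ ∣ γ ∣)
      signs-cancel γ = begin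
        sign ∣ γ ∣ * f γ * (sign ∣ γ ∣ * pow Y ∣ γ ∣ * pow (X - Y) (n ∸ ∣ γ ∣))
          ≈⟨ solve 4 (λ s a y d → s :* a :* (s :* y :* d) := (s :* s) :* (a :* y :* d)) refl
               (sign ∣ γ ∣) (f γ) (pow Y ∣ γ ∣) (pow (X - Y) (n ∸ ∣ γ ∣)) ⟩
        (sign ∣ γ ∣ * sign ∣ γ ∣) * (f γ * pow Y ∣ γ ∣ * pow (X - Y) (n ∸ ∣ γ ∣))
          ≈⟨ trans (*-cong (sign-square ∣ γ ∣) refl) (*-identityˡ _) ⟩
        f γ * pow Y ∣ γ ∣ * pow (X - Y) (n ∸ ∣ γ ∣) ∎

    complement-form : ∀ (f : Subset n → Carrier) →
      sumAll n (λ γ → f (∁ γ) * pow (X - Y) ∣ γ ∣ * pow Y (n ∸ ∣ γ ∣))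
        ≈ sumAll n (λ γ → f γ * pow Y ∣ γ ∣ * pow (X - Y) (n ∸ ∣ γ ∣))
    complement-form f = trans (sumAll-∁ n _) (sumAll-cong n reindex)
      where
      reindex : ∀ γ → f (∁ (∁ γ)) * pow (X - Y) ∣ ∁ γ ∣ * pow Y (n ∸ ∣ ∁ γ ∣)
                        ≈ f γ * pow Y ∣ γ ∣ * pow (X - Y) (n ∸ ∣ γ ∣)
      reindex γ = begin
        f (∁ (∁ γ)) * pow (X - Y) ∣ ∁ γ ∣ * pow Y (n ∸ ∣ ∁ γ ∣)
          ≈⟨ reflexive (≡.cong₂ (λ δ k → f δ * pow (X - Y) k * pow Y (n ∸ k)) (∁-involutive γ) (∣∁p∣≡n∸∣p∣ γ)) ⟩
        f γ * pow (X - Y) (n ∸ ∣ γ ∣) * pow Y (n ∸ (n ∸ ∣ γ ∣))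
          ≈⟨ *-cong refl (reflexive (≡.cong (pow Y) (m∸[m∸n]≡n (∣p∣≤n γ)))) ⟩
        f γ * pow (X - Y) (n ∸ ∣ γ ∣) * pow Y ∣ γ ∣
          ≈⟨ solve 3 (λ a d y → a :* d :* y := a :* y :* d) refl (f γ) (pow (X - Y) (n ∸ ∣ γ ∣)) (pow Y ∣ γ ∣) ⟩
        f γ * pow Y ∣ γ ∣ * pow (X - Y) (n ∸ ∣ γ ∣) ∎

    enumerator-by-subsets : ∀ (M : Matroid n) Z →
      W M X Y Z ≈ sumAll n (λ σ → coefficient ∣ σ ∣ * sumL (λ γ → sign ∣ γ ∣ * pow Z (nullity M γ)) (subsetsOf σ))
    enumerator-by-subsets M Z =
      trans (sumTo-cong n layer) (sumAll-bySize n (λ j σ → coefficient j * inner σ))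
      where
      inner : Subset n → Carrier
      inner σ = sumL (λ γ → sign ∣ γ ∣ * pow Z (nullity M γ)) (subsetsOf σ)
      layer : ∀ j → P M j Z * pow X (n ∸ j) * pow Y j ≈ sumL (λ σ → coefficient j * inner σ) (subsetsOfSize n j)
      layer j = begin
        P M j Z * pow X (n ∸ j) * pow Y j
          ≈⟨ *-cong (*-cong (P-formula M Z j) refl) refl ⟩
        sign j * sumL inner (subsetsOfSize n j) * pow X (n ∸ j) * pow Y j
          ≈⟨ solve 4 (λ s t x y → s :* t :* x :* y := s :* x :* y :* t) refl
               (sign j) (sumL inner (subsetsOfSize n j)) (pow X (n ∸ j)) (pow Y j) ⟩
        coefficient j * sumL inner (subsetsOfSize n j)
          ≈⟨ sym (sumL-*ˡ (coefficient j) inner (subsetsOfSize n j)) ⟩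
        sumL (λ σ → coefficient j * inner σ) (subsetsOfSize n j) ∎

lemma2 : ∀ {c ℓ} (R : CommutativeRing c ℓ) (n : ℕ) (M : Matroid n)
           (X Y Z : CommutativeRing.Carrier R) →
         let open CommutativeRing R
             open Poly R
         in W M X Y Z ≈
            sumTo n (λ j → sumL (λ γ → pow Z (nullity M (∁ γ)) * pow (X - Y) j * pow Y (n ∸ j))
                                (subsetsOfSize n j))
lemma2 R n M X Y Z = begin
  W M X Y Z
    ≈⟨ enumerator-by-subsets M Z ⟩
  sumAll n (λ σ → coefficient ∣ σ ∣ * sumL (λ γ → sign ∣ γ ∣ * f γ) (subsetsOf σ))
    ≈⟨ inversion f ⟩
  sumAll n (λ γ → f γ * pow Y ∣ γ ∣ * pow (X - Y) (n ∸ ∣ γ ∣))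
    ≈⟨ sym (complement-form f) ⟩
  sumAll n (λ γ → f (∁ γ) * pow (X - Y) ∣ γ ∣ * pow Y (n ∸ ∣ γ ∣))
    ≈⟨ sym (sumAll-bySize n (λ j γ → f (∁ γ) * pow (X - Y) j * pow Y (n ∸ j))) ⟩
  sumTo n (λ j → sumL (λ γ → f (∁ γ) * pow (X - Y) j * pow Y (n ∸ j)) (subsetsOfSize n j)) ∎
  where
  open CommutativeRing R
  open Poly R
  open Theory R
  open Inversion n X Y
  open SetoidReasoning setoid
  f : Subset n → Carrier
  f γ = pow Z (nullity M γ)
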